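{- Let $m \geq 5$ be an integer with $m \notin \{6, 9\}$. Then $m$ is prime if and only if $m$ does not divide $4(m-5)!$, i.e. $4(m-5)! \not\equiv 0 \pmod{m}$. Moreover, the equivalence fails for $m=6$ and for $m=9$: each of these satisfies $4(m-5)! \not\equiv 0 \pmod m$ without being prime. -}

module Defs where

-- A prime p ≥ 5 divides neither 4 nor any factor of (p − 5)!, so by Euclid's lemma
-- p ∤ 4 (p − 5)!. Conversely, a composite n ≥ 10 is a product ab of two factors > 1
-- whose larger one is at most n/2 ≤ n − 5: if a < b then ab ∣ b! ∣ (n − 5)!, and if
-- a = b then a ≥ 4 and ab ∣ a · 2a ∣ (n − 5)!. The cases 5 ≤ n < 10 are checked directly.
module Submission where

open import Defs
open import Data.Nat.Base using (ℕ; _≤_; _*_; _∸_; _!)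
open import Relation.Binary.PropositionalEquality using (_≢_)
open import Data.Nat.Divisibility using (_∣_)
open import Data.Nat.Primality using (Prime)
open import Data.Product using (_×_)
open import Function.Bundles using (_⇔_)
open import Relation.Nullary using (¬_)

open import Data.Nat.Base using (zero; suc; _+_; _<_; z≤n; s≤s; >-nonZero; nonTrivial⇒n>1; n>1⇒nonTrivial)
open import Data.Nat.Properties
open import Data.Nat.Divisibility
  using (divides; divides-refl; ∣-trans; ∣⇒≤; m∣m*n; n∣m*n; *-monoʳ-∣; m≤n⇒m!∣n!; quotient>1; _∣?_)
open import Data.Nat.Primality
  using (Composite; composite; euclidsLemma; prime⇒nonTrivial; prime?; ¬prime⇒composite)
open import Data.Product using (_,_)
open import Data.Sum using (inj₁; inj₂)
open import Relation.Binary.PropositionalEquality using (refl; cong; subst)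
open import Relation.Binary.Definitions using (tri<; tri≈; tri>)
open import Relation.Nullary using (yes; no; contradiction)
open import Relation.Nullary.Decidable using (from-yes; from-no)
open import Function.Bundles using (mk⇔)

prime∤n! : ∀ {p n} → Prime p → n < p → ¬ p ∣ n !
prime∤n! {p} {zero} pp _ p∣1 = <⇒≱ (nonTrivial⇒n>1 p {{prime⇒nonTrivial pp}}) (∣⇒≤ p∣1)
prime∤n! {p} {suc n} pp n<p p∣n! with euclidsLemma (suc n) (n !) pp p∣n!
... | inj₁ p∣1+n = <⇒≱ n<p (∣⇒≤ p∣1+n)
... | inj₂ p∣n!  = prime∤n! pp (<-trans (n<1+n n) n<p) p∣n!

prime∤m*n! : ∀ {p m n} → Prime p → 0 < m → m < p → n < p → ¬ p ∣ m * n !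
prime∤m*n! {m = m} {n} pp 0<m m<p n<p p∣m*n! with euclidsLemma m (n !) pp p∣m*n!
... | inj₁ p∣m  = <⇒≱ m<p (∣⇒≤ {{>-nonZero 0<m}} p∣m)
... | inj₂ p∣n! = prime∤n! pp n<p p∣n!

prime⇒∤4*[p∸5]! : ∀ {p} → 5 ≤ p → Prime p → ¬ p ∣ 4 * (p ∸ 5) !
prime⇒∤4*[p∸5]! {p} 5≤p pp = prime∤m*n! pp (s≤s z≤n) 5≤p (∸-monoʳ-< {p} {5} {0} (s≤s z≤n) 5≤p)

m∣m! : ∀ {m} → 0 < m → m ∣ m !
m∣m! {suc m} _ = m∣m*n (m !)

m*n∣o! : ∀ {m n o} → 0 < m → m < n → n ≤ o → m * n ∣ o !
m*n∣o! {m} {suc n} {o} 0<m (s≤s m≤n) 1+n≤o = ∣-trans m*[1+n]∣[1+n]! (m≤n⇒m!∣n! 1+n≤o)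
  where
  m*[1+n]∣[1+n]! : m * suc n ∣ suc n !
  m*[1+n]∣[1+n]! = subst (_∣ suc n !) (*-comm (suc n) m)
                     (*-monoʳ-∣ (suc n) (∣-trans (m∣m! 0<m) (m≤n⇒m!∣n! m≤n)))

2*n≤m⇒n≤m∸5 : ∀ {m n} → 10 ≤ m → 2 * n ≤ m → n ≤ m ∸ 5
2*n≤m⇒n≤m∸5 {m} {n} 10≤m 2*n≤m = m+n≤o⇒m≤o∸n n {o = m} (*-cancelˡ-≤ 2 (begin
  2 * (n + 5)   ≡⟨ *-distribˡ-+ 2 n 5 ⟩
  2 * n + 10    ≤⟨ +-mono-≤ 2*n≤m 10≤m ⟩
  m + m         ≡⟨ cong (m +_) (+-identityʳ m) ⟨
  2 * m         ∎))
  where open ≤-Reasoning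

m<n⇒m*n∣[m*n∸5]! : ∀ {m n} → 1 < m → m < n → 10 ≤ m * n → m * n ∣ (m * n ∸ 5) !
m<n⇒m*n∣[m*n∸5]! {m} {n} 1<m m<n 10≤m*n =
  m*n∣o! (<-trans (s≤s z≤n) 1<m) m<n (2*n≤m⇒n≤m∸5 10≤m*n (*-monoˡ-≤ n 1<m))

10≤n*n⇒4≤n : ∀ {n} → 10 ≤ n * n → 4 ≤ n
10≤n*n⇒4≤n {0} ()
10≤n*n⇒4≤n {1} (s≤s ())
10≤n*n⇒4≤n {2} (s≤s (s≤s (s≤s (s≤s ()))))
10≤n*n⇒4≤n {3} (s≤s (s≤s (s≤s (s≤s (s≤s (s≤s (s≤s (s≤s (s≤s ())))))))))
10≤n*n⇒4≤n {suc (suc (suc (suc n)))} _ = s≤s (s≤s (s≤s (s≤s z≤n)))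

-- n² ∣ n · 2n, and for n ≥ 4 the distinct factors n < 2n both fit below n² − 5.
n*n∣[n*n∸5]! : ∀ {n} → 10 ≤ n * n → n * n ∣ (n * n ∸ 5) !
n*n∣[n*n∸5]! {n} 10≤n*n = ∣-trans (*-monoʳ-∣ n (n∣m*n 2)) (m*n∣o! 0<n n<2*n 2*n≤n*n∸5)
  where
  4≤n : 4 ≤ n
  4≤n = 10≤n*n⇒4≤n 10≤n*n
  0<n : 0 < n
  0<n = ≤-trans (s≤s z≤n) 4≤n
  n<2*n : n < 2 * n
  n<2*n = subst (n <_) (*-comm n 2) (m<m*n n 2 {{>-nonZero 0<n}} ≤-refl)
  2*n≤n*n∸5 : 2 * n ≤ n * n ∸ 5
  2*n≤n*n∸5 = 2*n≤m⇒n≤m∸5 10≤n*n (subst (_≤ n * n) (*-assoc 2 2 n) (*-monoˡ-≤ n 4≤n))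

m*n∣[m*n∸5]! : ∀ {m n} → 1 < m → 1 < n → 10 ≤ m * n → m * n ∣ (m * n ∸ 5) !
m*n∣[m*n∸5]! {m} {n} 1<m 1<n 10≤m*n with <-cmp m n
... | tri< m<n _ _ = m<n⇒m*n∣[m*n∸5]! 1<m m<n 10≤m*n
... | tri≈ _ refl _ = n*n∣[n*n∸5]! {m} 10≤m*n
... | tri> _ _ n<m = subst (λ k → k ∣ (k ∸ 5) !) (*-comm n m)
                       (m<n⇒m*n∣[m*n∸5]! 1<n n<m (subst (10 ≤_) (*-comm m n) 10≤m*n))

composite⇒∣[n∸5]! : ∀ {n} → 10 ≤ n → Composite n → n ∣ (n ∸ 5) !
composite⇒∣[n∸5]! 10≤n (composite {d} d<n d∣n@(divides-refl q)) =
  m*n∣[m*n∸5]! (quotient>1 d∣n d<n) (nonTrivial⇒n>1 d) 10≤n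

¬prime⇒∣4*[n∸5]! : ∀ {n} → 10 ≤ n → ¬ Prime n → n ∣ 4 * (n ∸ 5) !
¬prime⇒∣4*[n∸5]! {n} 10≤n ¬pn = ∣-trans (composite⇒∣[n∸5]! 10≤n composite-n) (n∣m*n 4)
  where
  composite-n : Composite n
  composite-n = ¬prime⇒composite {{n>1⇒nonTrivial (≤-trans (s≤s (s≤s z≤n)) 10≤n)}} ¬pn

∤4*[n∸5]!⇒prime : ∀ n → 5 ≤ n → n ≢ 6 → n ≢ 9 → ¬ n ∣ 4 * (n ∸ 5) ! → Prime n
∤4*[n∸5]!⇒prime 1 (s≤s ())
∤4*[n∸5]!⇒prime 2 (s≤s (s≤s ()))
∤4*[n∸5]!⇒prime 3 (s≤s (s≤s (s≤s ())))
∤4*[n∸5]!⇒prime 4 (s≤s (s≤s (s≤s (s≤s ()))))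
∤4*[n∸5]!⇒prime 5 _ _ _ _ = from-yes (prime? 5)
∤4*[n∸5]!⇒prime 6 _ n≢6 _ _ = contradiction refl n≢6
∤4*[n∸5]!⇒prime 7 _ _ _ _ = from-yes (prime? 7)
∤4*[n∸5]!⇒prime 8 _ _ _ 8∤24 = contradiction (divides 3 refl) 8∤24
∤4*[n∸5]!⇒prime 9 _ _ n≢9 _ = contradiction refl n≢9
∤4*[n∸5]!⇒prime n@(suc (suc (suc (suc (suc (suc (suc (suc (suc (suc k)))))))))) _ _ _ n∤ with prime? n
... | yes pn = pn
... | no ¬pn = contradiction (¬prime⇒∣4*[n∸5]! (m≤m+n 10 k) ¬pn) n∤

theorem1 : ((m : ℕ) → 5 ≤ m → m ≢ 6 → m ≢ 9 → (Prime m ⇔ (¬ (m ∣ 4 * ((m ∸ 5) !)))))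
           × ((¬ (6 ∣ 4 * ((6 ∸ 5) !))) × ¬ Prime 6)
           × ((¬ (9 ∣ 4 * ((9 ∸ 5) !))) × ¬ Prime 9)
theorem1 =
    (λ m 5≤m m≢6 m≢9 → mk⇔ (prime⇒∤4*[p∸5]! 5≤m) (∤4*[n∸5]!⇒prime m 5≤m m≢6 m≢9))
  , (from-no (6 ∣? 4) , from-no (prime? 6))
  , (from-no (9 ∣? 96) , from-no (prime? 9))
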